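{- For every $n\ge 1$ there is a bijection between the set of partial permutations of length $n$ with exactly one hole that avoid $1234$ and the set of all lattice paths from $(0,0)$ to $(2n-2,0)$ with steps $(1,1)$ and $(1,-1)$.
   Context: A partial permutation of length $n$ with one hole is a sequence $\pi_1\cdots\pi_n$ in which each of $1,\dots,n-1$ appears exactly once and the remaining entry is a hole symbol $\diamond$. A permutation $\sigma$ of $[n]$ is an extension of $\pi$ if the standardization (order-preserving relabeling by $1,2,\dots$) of the restriction of $\sigma$ to the non-hole positions equals the restriction of $\pi$ to those positions. $\pi$ avoids a pattern $p$ if every extension of $\pi$ avoids $p$ in the classical sense. -}

module Defs where

open import Data.Nat using (ℕ; zero; suc; _+_; _*_; _∸_; _≤_; _<_; _<ᵇ_; _≡ᵇ_)
open import Data.Bool using (Bool; true; false; if_then_else_)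
open import Data.Maybe using (Maybe; just; nothing)
open import Data.List using (List; []; _∷_; length; map; catMaybes)
open import Data.Vec using (Vec; []; _∷_; toList; lookup)
open import Data.Fin using (Fin) renaming (_<_ to _<ᶠ_)
open import Data.Integer using (ℤ; +_; -[1+_]) renaming (_+_ to _+ℤ_)
open import Data.Product using (_×_; ∃-syntax)
open import Data.Refinement using (Refinement)
open import Relation.Nullary using (¬_)
open import Relation.Binary.PropositionalEquality using (_≡_)

count : ℕ → List ℕ → ℕ
count k []       = 0
count k (x ∷ xs) = (if x ≡ᵇ k then 1 else 0) + count k xs

-- number of holes (nothing = the hole symbol ◇)
holes : List (Maybe ℕ) → ℕ
holes []            = 0
holes (nothing ∷ xs) = suc (holes xs)
holes (just _ ∷ xs)  = holes xs

IsPermutation : (n : ℕ) → Vec ℕ n → Set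
IsPermutation n σ = ∀ k → 1 ≤ k → k ≤ n → count k (toList σ) ≡ 1

IsPartialPerm1 : (n : ℕ) → Vec (Maybe ℕ) n → Set
IsPartialPerm1 n π =
  holes (toList π) ≡ 1 ×
  (∀ k → 1 ≤ k → k ≤ n ∸ 1 → count k (catMaybes (toList π)) ≡ 1)

restrict : ∀ {n} → Vec ℕ n → Vec (Maybe ℕ) n → List ℕ
restrict []       []             = []
restrict (x ∷ xs) (nothing ∷ ps) = restrict xs ps
restrict (x ∷ xs) (just _ ∷ ps)  = x ∷ restrict xs ps

below : ℕ → List ℕ → ℕ
below x []       = 0
below x (y ∷ ys) = (if y <ᵇ x then 1 else 0) + below x ys

-- standardization (order-preserving relabeling by 1,2,...) of a word
-- with distinct entries
standardize : List ℕ → List ℕ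
standardize w = map (λ x → suc (below x w)) w

IsExtension : ∀ {n} → Vec (Maybe ℕ) n → Vec ℕ n → Set
IsExtension {n} π σ =
  IsPermutation n σ × standardize (restrict σ π) ≡ catMaybes (toList π)

Contains1234 : ∀ {n} → Vec ℕ n → Set
Contains1234 {n} σ =
  ∃[ i ] ∃[ j ] ∃[ k ] ∃[ l ]
    (i <ᶠ j × j <ᶠ k × k <ᶠ l ×
     lookup σ i < lookup σ j × lookup σ j < lookup σ k × lookup σ k < lookup σ l)

Avoids1234 : ∀ {n} → Vec ℕ n → Set
Avoids1234 σ = ¬ Contains1234 σ

PPAvoids1234 : ∀ {n} → Vec (Maybe ℕ) n → Set
PPAvoids1234 {n} π = (σ : Vec ℕ n) → IsExtension π σ → Avoids1234 σ

PP1234 : ℕ → Set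
PP1234 n = Refinement (Vec (Maybe ℕ) n) (λ π → IsPartialPerm1 n π × PPAvoids1234 π)

data Step : Set where
  up down : Step

height : ∀ {m} → Vec Step m → ℤ
height []          = + 0
height (up ∷ s)    = + 1 +ℤ height s
height (down ∷ s)  = -[1+ 0 ] +ℤ height s

-- lattice paths from (0,0) to (2n-2,0) with steps (1,1),(1,-1)
-- (no nonnegativity constraint)
LatticePaths : ℕ → Set
LatticePaths n = Refinement (Vec Step (2 * n ∸ 2)) (λ s → height s ≡ + 0)

module Submission where

-- Write a one-hole partial permutation of length m + 1 as the position of its hole together with the
-- permutation σ of [m] formed by its entries.  It avoids 1234 exactly when σ avoids 123: deleting the
-- hole's entry from a 1234 of an extension leaves a 123 in σ, and conversely a 123 of σ extends to a
-- 1234 once the hole is filled with a suitable value.  So there are (m + 1) |Av_m(123)| of them.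
-- Splitting off the first entry of a 123-avoider, while keeping track of the largest value at which an
-- ascent may start, yields the ballot recursion, whence (m + 1) |Av_m(123)| = C(2m, m): the number of
-- ±1 paths of length 2m that return to 0.

open import Defs
open import Data.Bool using (true; false; if_then_else_)
open import Data.Empty using (⊥-elim-irr)
open import Data.Fin using (Fin; zero; suc) renaming (_<_ to _<ᶠ_)
open import Data.Fin.Properties using (+↔⊎; *↔×; 0↔⊥) renaming (_≟_ to Fin-≟)
import Data.Irrelevant as Irr
open import Data.List using (List; []; _∷_; length; catMaybes)
import Data.List as List
open import Data.List.Membership.Propositional using (_∈_)
open import Data.List.Properties using (map-id-local) renaming (map-cong to List-map-cong; map-∘ to List-map-∘)
open import Data.List.Relation.Unary.All as All using (All; []; _∷_)
open import Data.List.Relation.Unary.Any as Any using (Any; here; there)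
open import Data.Maybe using (Maybe; just; nothing; fromMaybe)
open import Data.Maybe.Properties using () renaming (≡-dec to Maybe-≡-dec)
open import Data.Nat using (ℕ; zero; suc; pred; _+_; _*_; _∸_; _⊓_; _≤_; _<_; _<ᵇ_; _≡ᵇ_; z≤n; s≤s; _≤?_; _<?_; _≟_)
open import Data.Nat.Combinatorics using (_C_; nCk+nC[k+1]≡[n+1]C[k+1]; k>n⇒nCk≡0; nC1≡n; nCk≡nC[n∸k])
open import Data.Nat.Properties
import Data.Nat.Tactic.RingSolver as ℕ-Solver
open import Data.Product as Product using (_×_; _,_; proj₁; proj₂; ∃-syntax; uncurry)
open import Data.Product.Function.NonDependent.Propositional using (_×-↔_)
open import Data.Product.Properties using () renaming (≡-dec to ×-≡-dec)
open import Data.Refinement as Ref using (Refinement; _,_; value-injective)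
open import Data.Sum using (_⊎_; inj₁; inj₂)
open import Data.Sum.Function.Propositional using (_⊎-↔_)
open import Data.Unit using (tt)
open import Data.Vec using (Vec; []; _∷_; toList; lookup; map; insertAt; removeAt)
open import Data.Vec.Properties
  using (length-toList; toList-map; map-∘; map-cong; map-id; removeAt-insertAt) renaming (≡-dec to Vec-≡-dec)
open import Function.Base using (id; _∘_)
open import Function.Bundles using (_↔_; _⤖_; _⇔_; mk↔ₛ′; mk⇔; Equivalence)
open import Function.Properties.Inverse using (↔-refl; ↔-sym; ↔-trans; ↔⇒⤖)
open import Function.Related.Propositional using (module EquationalReasoning)
open import Relation.Nullary using (¬_; Dec; yes; no; contradiction)
open import Relation.Nullary.Decidable using (proof; recompute; ¬?; _×-dec_; decidable-stable)
open import Relation.Nullary.Reflects using (Reflects; ofʸ; ofⁿ)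
open import Relation.Unary using (Decidable)
open import Relation.Binary.Definitions using (DecidableEquality; tri<; tri≈; tri>)
open import Relation.Binary.PropositionalEquality
  using (_≡_; _≢_; refl; sym; trans; cong; cong₂; subst; module ≡-Reasoning)

refinement-↔ : ∀ {A B : Set} {P : A → Set} {Q : B → Set} → DecidableEquality A → DecidableEquality B →
               (f : A → B) (g : B → A) → (∀ {a} → P a → Q (f a)) → (∀ {b} → Q b → P (g b)) →
               (∀ {b} → Q b → f (g b) ≡ b) → (∀ {a} → P a → g (f a) ≡ a) →
               Refinement A P ↔ Refinement B Q
refinement-↔ _≟ᴬ_ _≟ᴮ_ f g f-resp g-resp f∘g g∘f = mk↔ₛ′ (Ref.map f f-resp) (Ref.map g g-resp)
  (λ { (b , Irr.[ q ]) → value-injective (recompute (f (g b) ≟ᴮ b) (f∘g q)) })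
  (λ { (a , Irr.[ p ]) → value-injective (recompute (g (f a) ≟ᴬ a) (g∘f p)) })

refinement-split : ∀ {A : Set} {P D : A → Set} → Decidable D →
                   Refinement A P ↔ (Refinement A (λ a → P a × D a) ⊎ Refinement A (λ a → P a × ¬ D a))
refinement-split {A} {P} {D} D? = mk↔ₛ′ split join split∘join join∘split
  where
  split : Refinement A P → Refinement A (λ a → P a × D a) ⊎ Refinement A (λ a → P a × ¬ D a)
  split (a , p) with D? a
  ... | yes d = inj₁ (a , Irr.map (_, d) p)
  ... | no ¬d = inj₂ (a , Irr.map (_, ¬d) p)
  join : Refinement A (λ a → P a × D a) ⊎ Refinement A (λ a → P a × ¬ D a) → Refinement A P
  join (inj₁ (a , pd)) = a , Irr.map proj₁ pd
  join (inj₂ (a , pd)) = a , Irr.map proj₁ pd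
  split∘join : ∀ x → split (join x) ≡ x
  split∘join (inj₁ (a , Irr.[ pd ])) with D? a
  ... | yes _ = refl
  ... | no ¬d = ⊥-elim-irr (¬d (proj₂ pd))
  split∘join (inj₂ (a , Irr.[ pd ])) with D? a
  ... | yes d = ⊥-elim-irr (proj₂ pd d)
  ... | no _  = refl
  join∘split : ∀ x → join (split x) ≡ x
  join∘split (a , p) with D? a
  ... | yes _ = refl
  ... | no _  = refl

refinement-proj₂↔× : ∀ {A B : Set} {Q : B → Set} → Refinement (A × B) (Q ∘ proj₂) ↔ (A × Refinement B Q)
refinement-proj₂↔× = mk↔ₛ′ (λ ((a , b) , q) → a , (b , q)) (λ (a , (b , q)) → (a , b) , q)
  (λ _ → refl) (λ _ → refl)

≡ᵇ-reflects-≡ : ∀ m n → Reflects (m ≡ n) (m ≡ᵇ n)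
≡ᵇ-reflects-≡ m n = proof (m ≟ n)

count-cons-≡ : ∀ {x k} w → x ≡ k → count k (x ∷ w) ≡ suc (count k w)
count-cons-≡ {x} {k} w x≡k with x ≡ᵇ k | ≡ᵇ-reflects-≡ x k
... | true  | _        = refl
... | false | ofⁿ x≢k = contradiction x≡k x≢k

count-cons-≢ : ∀ {x k} w → x ≢ k → count k (x ∷ w) ≡ count k w
count-cons-≢ {x} {k} w x≢k with x ≡ᵇ k | ≡ᵇ-reflects-≡ x k
... | true  | ofʸ x≡k = contradiction x≡k x≢k
... | false | _        = refl

count≡0⇒∉ : ∀ k w → count k w ≡ 0 → All (_≢ k) w
count≡0⇒∉ k []      _ = []
count≡0⇒∉ k (x ∷ w) c with x ≟ k
... | yes x≡k = contradiction (trans (sym (count-cons-≡ w x≡k)) c) λ ()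
... | no  x≢k = x≢k ∷ count≡0⇒∉ k w (trans (sym (count-cons-≢ w x≢k)) c)

count≡1⇒∈ : ∀ k w → count k w ≡ 1 → Any (_≡ k) w
count≡1⇒∈ k (x ∷ w) c with x ≟ k
... | yes x≡k = here x≡k
... | no  x≢k = there (count≡1⇒∈ k w (trans (sym (count-cons-≢ w x≢k)) c))

count-map : ∀ (f : ℕ → ℕ) {k k′} → (∀ {x} → f x ≡ k → x ≡ k′) → (∀ {x} → x ≡ k′ → f x ≡ k) →
            ∀ w → count k (List.map f w) ≡ count k′ w
count-map f to from []      = refl
count-map f {k′ = k′} to from (x ∷ w) with x ≟ k′
... | yes x≡k′ = trans (count-cons-≡ (List.map f w) (from x≡k′))
                   (trans (cong suc (count-map f to from w)) (sym (count-cons-≡ w x≡k′)))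
... | no  x≢k′ = trans (count-cons-≢ (List.map f w) (λ fx≡k → x≢k′ (to fx≡k)))
                   (trans (count-map f to from w) (sym (count-cons-≢ w x≢k′)))

-- As Data.Fin.punchIn/punchOut: punchIn v makes room for the value v, punchOut v closes the gap again
-- (punchOut v v is junk).
punchIn : ℕ → ℕ → ℕ
punchIn v x = if x <ᵇ v then x else suc x

punchOut : ℕ → ℕ → ℕ
punchOut v x = if v <ᵇ x then pred x else x

punchIn-< : ∀ {v x} → x < v → punchIn v x ≡ x
punchIn-< {v} {x} x<v with x <ᵇ v | <ᵇ-reflects-< x v
... | true  | _        = refl
... | false | ofⁿ x≮v = contradiction x<v x≮v

punchIn-≥ : ∀ {v x} → v ≤ x → punchIn v x ≡ suc x
punchIn-≥ {v} {x} v≤x with x <ᵇ v | <ᵇ-reflects-< x v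
... | true  | ofʸ x<v = contradiction v≤x (<⇒≱ x<v)
... | false | _        = refl

punchOut-> : ∀ {v x} → v < x → punchOut v x ≡ pred x
punchOut-> {v} {x} v<x with v <ᵇ x | <ᵇ-reflects-< v x
... | true  | _        = refl
... | false | ofⁿ v≮x = contradiction v<x v≮x

punchOut-≤ : ∀ {v x} → x ≤ v → punchOut v x ≡ x
punchOut-≤ {v} {x} x≤v with v <ᵇ x | <ᵇ-reflects-< v x
... | true  | ofʸ v<x = contradiction x≤v (<⇒≱ v<x)
... | false | _        = refl

punchIn-mono-< : ∀ v {x y} → x < y → punchIn v x < punchIn v y
punchIn-mono-< v {x} {y} x<y with x <? v | y <? v
... | yes x<v | yes y<v rewrite punchIn-< x<v | punchIn-< y<v = x<y
... | yes x<v | no  y≮v rewrite punchIn-< x<v | punchIn-≥ (≮⇒≥ y≮v) = m<n⇒m<1+n x<y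
... | no  x≮v | yes y<v = contradiction (<-trans x<y y<v) x≮v
... | no  x≮v | no  y≮v rewrite punchIn-≥ (≮⇒≥ x≮v) | punchIn-≥ (≮⇒≥ y≮v) = s≤s x<y

punchIn-cancel-< : ∀ v {x y} → punchIn v x < punchIn v y → x < y
punchIn-cancel-< v {x} {y} p with <-cmp x y
... | tri< x<y _ _ = x<y
... | tri≈ _ refl _ = contradiction p (<-irrefl refl)
... | tri> _ _ y<x = contradiction p (<-asym (punchIn-mono-< v y<x))

punchIn-≥-suc : ∀ {v x} → v ≤ x → suc v ≤ punchIn v x
punchIn-≥-suc v≤x = ≤-trans (s≤s v≤x) (≤-reflexive (sym (punchIn-≥ v≤x)))

punchIn-cancel-≤ : ∀ v {t x} → t ≤ punchIn v x → t ⊓ v ≤ x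
punchIn-cancel-≤ v {t} {x} t≤x′ with x <? v
... | yes x<v = ≤-trans (m⊓n≤m t v) (≤-trans t≤x′ (≤-reflexive (punchIn-< x<v)))
... | no  x≮v = ≤-trans (m⊓n≤n t v) (≮⇒≥ x≮v)

punchIn≢ : ∀ v x → punchIn v x ≢ v
punchIn≢ v x with x <? v
... | yes x<v = λ eq → <-irrefl (trans (sym (punchIn-< x<v)) eq) x<v
... | no  x≮v = λ eq → <-irrefl (trans (sym eq) (punchIn-≥ (≮⇒≥ x≮v))) (s≤s (≮⇒≥ x≮v))

≤-punchIn : ∀ v x → x ≤ punchIn v x
≤-punchIn v x with x <? v
... | yes x<v = ≤-reflexive (sym (punchIn-< x<v))
... | no  x≮v = ≤-trans (n≤1+n x) (≤-reflexive (sym (punchIn-≥ (≮⇒≥ x≮v))))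

punchIn-≤-suc : ∀ v x → punchIn v x ≤ suc x
punchIn-≤-suc v x with x <? v
... | yes x<v = ≤-trans (≤-reflexive (punchIn-< x<v)) (n≤1+n x)
... | no  x≮v = ≤-reflexive (punchIn-≥ (≮⇒≥ x≮v))

punchOut-punchIn : ∀ v x → punchOut v (punchIn v x) ≡ x
punchOut-punchIn v x with x <? v
... | yes x<v rewrite punchIn-< x<v = punchOut-≤ (<⇒≤ x<v)
... | no  x≮v rewrite punchIn-≥ (≮⇒≥ x≮v) = punchOut-> (s≤s (≮⇒≥ x≮v))

punchIn-punchOut : ∀ {v x} → x ≢ v → punchIn v (punchOut v x) ≡ x
punchIn-punchOut {v} {x} x≢v with v <? x
punchIn-punchOut {v} {suc x} _ | yes v<x rewrite punchOut-> v<x = punchIn-≥ (≤-pred v<x)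
... | no  v≮x rewrite punchOut-≤ (≮⇒≥ v≮x) = punchIn-< (≤∧≢⇒< (≮⇒≥ v≮x) x≢v)

count-map-punchIn : ∀ v {k} → k ≢ v → ∀ w → count k (List.map (punchIn v) w) ≡ count (punchOut v k) w
count-map-punchIn v k≢v =
  count-map (punchIn v) (λ { refl → sym (punchOut-punchIn v _) }) (λ { refl → punchIn-punchOut k≢v })

count-map-punchIn-self : ∀ v w → count v (List.map (punchIn v) w) ≡ 0
count-map-punchIn-self v []      = refl
count-map-punchIn-self v (x ∷ w) = trans (count-cons-≢ (List.map (punchIn v) w) (punchIn≢ v x)) (count-map-punchIn-self v w)

map-punchIn-punchOut : ∀ v {m} (τ : Vec ℕ m) → All (_≢ v) (toList τ) → map (punchIn v) (map (punchOut v) τ) ≡ τ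
map-punchIn-punchOut v []      []          = refl
map-punchIn-punchOut v (x ∷ τ) (x≢v ∷ τ≢v) = cong₂ _∷_ (punchIn-punchOut x≢v) (map-punchIn-punchOut v τ τ≢v)

count-map-punchOut : ∀ v k {m} (τ : Vec ℕ m) → All (_≢ v) (toList τ) →
                     count k (toList (map (punchOut v) τ)) ≡ count (punchIn v k) (toList τ)
count-map-punchOut v k τ v∉τ = begin
  count k (toList (map (punchOut v) τ))
    ≡⟨ cong (λ k′ → count k′ (toList (map (punchOut v) τ))) (punchOut-punchIn v k) ⟨
  count (punchOut v (punchIn v k)) (toList (map (punchOut v) τ))
    ≡⟨ count-map-punchIn v (punchIn≢ v k) (toList (map (punchOut v) τ)) ⟨
  count (punchIn v k) (List.map (punchIn v) (toList (map (punchOut v) τ)))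
    ≡⟨ cong (count (punchIn v k)) (toList-map (punchIn v) (map (punchOut v) τ)) ⟨
  count (punchIn v k) (toList (map (punchIn v) (map (punchOut v) τ)))
    ≡⟨ cong (λ τ′ → count (punchIn v k) (toList τ′)) (map-punchIn-punchOut v τ v∉τ) ⟩
  count (punchIn v k) (toList τ)                                        ∎
  where open ≡-Reasoning

[_<ᵇ_] : ℕ → ℕ → ℕ
[ y <ᵇ x ] = if y <ᵇ x then 1 else 0

[_≡ᵇ_] : ℕ → ℕ → ℕ
[ y ≡ᵇ x ] = if y ≡ᵇ x then 1 else 0

[≡ᵇ]+[<ᵇ] : ∀ y x → [ y ≡ᵇ x ] + [ y <ᵇ x ] ≡ [ y <ᵇ suc x ]
[≡ᵇ]+[<ᵇ] zero    zero    = refl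
[≡ᵇ]+[<ᵇ] zero    (suc x) = refl
[≡ᵇ]+[<ᵇ] (suc y) zero    = refl
[≡ᵇ]+[<ᵇ] (suc y) (suc x) = [≡ᵇ]+[<ᵇ] y x

countBelow : ℕ → List ℕ → ℕ
countBelow zero    w = 0
countBelow (suc x) w = count x w + countBelow x w

countBelow-[] : ∀ x → countBelow x [] ≡ 0
countBelow-[] zero    = refl
countBelow-[] (suc x) = countBelow-[] x

countBelow-cons : ∀ x y w → countBelow x (y ∷ w) ≡ [ y <ᵇ x ] + countBelow x w
countBelow-cons zero    y w = refl
countBelow-cons (suc x) y w = begin
  ([ y ≡ᵇ x ] + count x w) + countBelow x (y ∷ w)
    ≡⟨ cong (([ y ≡ᵇ x ] + count x w) +_) (countBelow-cons x y w) ⟩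
  ([ y ≡ᵇ x ] + count x w) + ([ y <ᵇ x ] + countBelow x w)
    ≡⟨ +-interchange [ y ≡ᵇ x ] (count x w) [ y <ᵇ x ] (countBelow x w) ⟩
  ([ y ≡ᵇ x ] + [ y <ᵇ x ]) + (count x w + countBelow x w)
    ≡⟨ cong (_+ countBelow (suc x) w) ([≡ᵇ]+[<ᵇ] y x) ⟩
  [ y <ᵇ suc x ] + countBelow (suc x) w                   ∎
  where open ≡-Reasoning
        open import Algebra.Properties.CommutativeSemigroup +-commutativeSemigroup renaming (interchange to +-interchange)

below≡countBelow : ∀ x w → below x w ≡ countBelow x w
below≡countBelow x []      = sym (countBelow-[] x)
below≡countBelow x (y ∷ w) = trans (cong ([ y <ᵇ x ] +_) (below≡countBelow x w)) (sym (countBelow-cons x y w))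

below≤length : ∀ x w → below x w ≤ length w
below≤length x []      = z≤n
below≤length x (y ∷ w) with y <ᵇ x
... | true  = s≤s (below≤length x w)
... | false = m≤n⇒m≤1+n (below≤length x w)

length≤below⇒All< : ∀ x w → length w ≤ below x w → All (_< x) w
length≤below⇒All< x []      _ = []
length≤below⇒All< x (y ∷ w) h with y <ᵇ x | <ᵇ-reflects-< y x
... | true  | ofʸ y<x = y<x ∷ length≤below⇒All< x w (≤-pred h)
... | false | _        = contradiction (below≤length x w) (<⇒≱ h)

module _ {m} {σ : Vec ℕ m} (σ-perm : IsPermutation m σ) where

  countBelow-perm : ∀ j → j ≤ m → countBelow (suc j) (toList σ) ≡ count 0 (toList σ) + j
  countBelow-perm zero    _   = refl
  countBelow-perm (suc j) j<m = begin
    count (suc j) (toList σ) + countBelow (suc j) (toList σ)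
      ≡⟨ cong₂ _+_ (σ-perm (suc j) (s≤s z≤n) j<m) (countBelow-perm j (<⇒≤ j<m)) ⟩
    suc (count 0 (toList σ) + j)
      ≡⟨ +-suc (count 0 (toList σ)) j ⟨
    count 0 (toList σ) + suc j                                 ∎
    where open ≡-Reasoning

  below-perm-suc : ∀ j → j ≤ m → below (suc j) (toList σ) ≡ count 0 (toList σ) + j
  below-perm-suc j j≤m = trans (below≡countBelow (suc j) (toList σ)) (countBelow-perm j j≤m)

  -- Pigeonhole: the values 1, …, m occur once each among the m entries, so there is no room for others.
  count0-perm : count 0 (toList σ) ≡ 0
  count0-perm = n≤0⇒n≡0 (+-cancelʳ-≤ m (count 0 (toList σ)) 0 (begin
    count 0 (toList σ) + m    ≡⟨ below-perm-suc m ≤-refl ⟨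
    below (suc m) (toList σ)  ≤⟨ below≤length (suc m) (toList σ) ⟩
    length (toList σ)         ≡⟨ length-toList σ ⟩
    m                         ∎))
    where open ≤-Reasoning

  perm-range : All (λ x → 1 ≤ x × x ≤ m) (toList σ)
  perm-range = All.zipWith (λ (x≢0 , x<1+m) → n≢0⇒n>0 x≢0 , ≤-pred x<1+m)
    (count≡0⇒∉ 0 (toList σ) count0-perm , length≤below⇒All< (suc m) (toList σ) length≤below)
    where
    open ≤-Reasoning
    length≤below : length (toList σ) ≤ below (suc m) (toList σ)
    length≤below = begin
      length (toList σ)           ≡⟨ length-toList σ ⟩
      m                           ≡⟨ cong (_+ m) count0-perm ⟨
      count 0 (toList σ) + m      ≡⟨ below-perm-suc m ≤-refl ⟨
      below (suc m) (toList σ)    ∎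

  standardize-perm : standardize (toList σ) ≡ toList σ
  standardize-perm = map-id-local (All.map below-suc perm-range)
    where
    below-suc : ∀ {x} → 1 ≤ x × x ≤ m → suc (below x (toList σ)) ≡ x
    below-suc {suc x} (_ , x<m) = cong suc (trans (below-perm-suc x (<⇒≤ x<m)) (cong (_+ x) count0-perm))

punchOut-range : ∀ {m v k} → 1 ≤ v → v ≤ suc m → 1 ≤ k → k ≤ suc m → k ≢ v →
                 1 ≤ punchOut v k × punchOut v k ≤ m
punchOut-range {m} {v} {k} 1≤v v≤1+m 1≤k k≤1+m k≢v with v <? k
punchOut-range {m} {v} {suc k} 1≤v _ _ k<1+m _ | yes v<k rewrite punchOut-> v<k =
  ≤-trans 1≤v (≤-pred v<k) , ≤-pred k<1+m
... | no v≮k rewrite punchOut-≤ (≮⇒≥ v≮k) = 1≤k , ≤-pred (≤-trans (≤∧≢⇒< (≮⇒≥ v≮k) k≢v) v≤1+m)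

perm-cons : ∀ {m v} {σ : Vec ℕ m} → IsPermutation m σ → 1 ≤ v → v ≤ suc m →
            IsPermutation (suc m) (v ∷ map (punchIn v) σ)
perm-cons {m} {v} {σ} σ-perm 1≤v v≤1+m k 1≤k k≤1+m rewrite toList-map (punchIn v) σ with v ≟ k
... | yes refl = trans (count-cons-≡ (List.map (punchIn v) (toList σ)) refl) (cong suc (count-map-punchIn-self v (toList σ)))
... | no  v≢k = begin
  count k (v ∷ List.map (punchIn v) (toList σ))   ≡⟨ count-cons-≢ (List.map (punchIn v) (toList σ)) v≢k ⟩
  count k (List.map (punchIn v) (toList σ))       ≡⟨ count-map-punchIn v k≢v (toList σ) ⟩
  count (punchOut v k) (toList σ)                 ≡⟨ σ-perm (punchOut v k) 1≤k′ k′≤m ⟩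
  1                                               ∎
  where
  open ≡-Reasoning
  k≢v : k ≢ v
  k≢v k≡v = v≢k (sym k≡v)
  1≤k′ : 1 ≤ punchOut v k
  1≤k′ = proj₁ (punchOut-range 1≤v v≤1+m 1≤k k≤1+m k≢v)
  k′≤m : punchOut v k ≤ m
  k′≤m = proj₂ (punchOut-range 1≤v v≤1+m 1≤k k≤1+m k≢v)

perm-head∉tail : ∀ {m v} {τ : Vec ℕ m} → IsPermutation (suc m) (v ∷ τ) → All (_≢ v) (toList τ)
perm-head∉tail {m} {v} {τ} vτ-perm = count≡0⇒∉ v (toList τ) (suc-injective (begin
  suc (count v (toList τ))  ≡⟨ count-cons-≡ (toList τ) refl ⟨
  count v (v ∷ toList τ)    ≡⟨ vτ-perm v 1≤v v≤1+m ⟩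
  1                         ∎))
  where
  open ≡-Reasoning
  1≤v : 1 ≤ v
  1≤v = proj₁ (All.head (perm-range {σ = v ∷ τ} vτ-perm))
  v≤1+m : v ≤ suc m
  v≤1+m = proj₂ (All.head (perm-range {σ = v ∷ τ} vτ-perm))

perm-uncons : ∀ {m v} {τ : Vec ℕ m} → IsPermutation (suc m) (v ∷ τ) → IsPermutation m (map (punchOut v) τ)
perm-uncons {m} {v} {τ} vτ-perm k 1≤k k≤m = begin
  count k (toList (map (punchOut v) τ))
    ≡⟨ count-map-punchOut v k τ (perm-head∉tail {τ = τ} vτ-perm) ⟩
  count (punchIn v k) (toList τ)
    ≡⟨ count-cons-≢ (toList τ) (λ v≡k′ → punchIn≢ v k (sym v≡k′)) ⟨
  count (punchIn v k) (v ∷ toList τ)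
    ≡⟨ vτ-perm (punchIn v k) (≤-trans 1≤k (≤-punchIn v k)) (≤-trans (punchIn-≤-suc v k) (s≤s k≤m)) ⟩
  1                                           ∎
  where open ≡-Reasoning

count-insertAt : ∀ {m} k (ρ : Vec ℕ m) i x → count k (toList (insertAt ρ i x)) ≡ count k (x ∷ toList ρ)
count-insertAt k ρ       zero    x = refl
count-insertAt k (y ∷ ρ) (suc i) x = begin
  [ y ≡ᵇ k ] + count k (toList (insertAt ρ i x))   ≡⟨ cong ([ y ≡ᵇ k ] +_) (count-insertAt k ρ i x) ⟩
  [ y ≡ᵇ k ] + ([ x ≡ᵇ k ] + count k (toList ρ))   ≡⟨ x∙yz≈y∙xz [ y ≡ᵇ k ] [ x ≡ᵇ k ] (count k (toList ρ)) ⟩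
  [ x ≡ᵇ k ] + ([ y ≡ᵇ k ] + count k (toList ρ))   ∎
  where open ≡-Reasoning
        open import Algebra.Properties.CommutativeSemigroup +-commutativeSemigroup using (x∙yz≈y∙xz)

-- Increasing subsequences

-- Incr k t w : w has an increasing subsequence of length k whose entries are all ≥ t.
data Incr : ℕ → ℕ → List ℕ → Set where
  done : ∀ {t w} → Incr 0 t w
  take : ∀ {k t x w} → t ≤ x → Incr k (suc x) w → Incr (suc k) t (x ∷ w)
  skip : ∀ {k t x w} → Incr k t w → Incr k t (x ∷ w)

incr? : ∀ k t w → Dec (Incr k t w)
incr? zero    t w       = yes done
incr? (suc k) t []      = no λ ()
incr? (suc k) t (x ∷ w) with t ≤? x | incr? k (suc x) w | incr? (suc k) t w
... | yes t≤x | yes rest | _        = yes (take t≤x rest)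
... | _       | _        | yes tail = yes (skip tail)
... | no  t≰x | _        | no  ¬tail = no λ { (take t≤x _) → t≰x t≤x ; (skip tail) → ¬tail tail }
... | yes _   | no ¬rest | no  ¬tail = no λ { (take _ rest) → ¬rest rest ; (skip tail) → ¬tail tail }

incr-lower : ∀ {k s t w} → s ≤ t → Incr k t w → Incr k s w
incr-lower s≤t done          = done
incr-lower s≤t (take t≤x p)  = take (≤-trans s≤t t≤x) p
incr-lower s≤t (skip p)      = skip (incr-lower s≤t p)

incr-shorten : ∀ {k t w} → Incr (suc k) t w → Incr k t w
incr-shorten {zero}  _            = done
incr-shorten {suc k} (take t≤x p) = take t≤x (incr-shorten p)
incr-shorten {suc k} (skip p)     = skip (incr-shorten p)

incr-bound : ∀ {m k t w} → All (_≤ m) w → Incr (suc k) t w → t + k ≤ m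
incr-bound {k = zero}  {t} (x≤m ∷ _) (take t≤x _) = ≤-trans (≤-reflexive (+-identityʳ t)) (≤-trans t≤x x≤m)
incr-bound {k = suc k} {t} (_ ∷ w≤m) (take t≤x p) =
  ≤-trans (≤-reflexive (+-suc t k)) (≤-trans (s≤s (+-monoˡ-≤ k t≤x)) (incr-bound w≤m p))
incr-bound (_ ∷ w≤m) (skip p) = incr-bound w≤m p

incr-map : ∀ {P : ℕ → Set} (f : ℕ → ℕ) → (∀ {x y} → P x → x < y → f x < f y) →
           ∀ {k t t′ w} → All P w → (∀ {x} → P x → t ≤ x → t′ ≤ f x) → Incr k t w → Incr k t′ (List.map f w)
incr-map f mono _          _ done           = done
incr-map f mono (px ∷ Pw) th (take t≤x p) = take (th px t≤x) (incr-map f mono Pw (λ _ → mono px) p)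
incr-map f mono (_ ∷ Pw)  th (skip p)     = skip (incr-map f mono Pw th p)

incr-map⁻ : ∀ (f : ℕ → ℕ) → (∀ {x y} → f x < f y → x < y) →
            ∀ {k t t′} w → (∀ {x} → t′ ≤ f x → t ≤ x) → Incr k t′ (List.map f w) → Incr k t w
incr-map⁻ f cancel []      th done = done
incr-map⁻ f cancel (x ∷ w) th done = done
incr-map⁻ f cancel (x ∷ w) th (take t′≤fx p) = take (th t′≤fx) (incr-map⁻ f cancel w cancel p)
incr-map⁻ f cancel (x ∷ w) th (skip p)       = skip (incr-map⁻ f cancel w th p)

incr-map-mono : ∀ (f : ℕ → ℕ) → (∀ {x y} → x < y → f x < f y) →
                ∀ {k t t′ w} → (∀ {x} → t ≤ x → t′ ≤ f x) → Incr k t w → Incr k t′ (List.map f w)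
incr-map-mono f mono {w = w} th = incr-map f (λ _ → mono) (All.universal (λ _ → tt) w) (λ _ → th)

any⇒incr₁ : ∀ {t w} → Any (t ≤_) w → Incr 1 t w
any⇒incr₁ (here t≤x) = take t≤x done
any⇒incr₁ (there p)  = skip (any⇒incr₁ p)

incr-⊓ : ∀ {k s t w} → Incr k (s ⊓ t) w → Incr k s w ⊎ Incr k t w
incr-⊓ {k} {s} {t} {w} p with ⊓-sel s t
... | inj₁ s⊓t≡s = inj₁ (subst (λ u → Incr k u w) s⊓t≡s p)
... | inj₂ s⊓t≡t = inj₂ (subst (λ u → Incr k u w) s⊓t≡t p)

incr-rebase : ∀ {k s t w} → All (t ≤_) w → Incr k s w → Incr k t w
incr-rebase _          done         = done
incr-rebase (t≤x ∷ _)  (take _ p)   = take t≤x p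
incr-rebase (_ ∷ t≤w)  (skip p)     = skip (incr-rebase t≤w p)

incr-removeAt : ∀ {m k t} (τ : Vec ℕ (suc m)) i → Incr (suc k) t (toList τ) → Incr k t (toList (removeAt τ i))
incr-removeAt (x ∷ τ)     zero    (take t≤x p) = incr-lower (≤-trans t≤x (n≤1+n x)) p
incr-removeAt (x ∷ τ)     zero    (skip p)     = incr-shorten p
incr-removeAt {k = zero}  (x ∷ y ∷ τ) (suc i) _ = done
incr-removeAt {k = suc k} (x ∷ y ∷ τ) (suc i) (take t≤x p) = take t≤x (incr-removeAt (y ∷ τ) i p)
incr-removeAt {k = suc k} (x ∷ y ∷ τ) (suc i) (skip p)     = skip (incr-removeAt (y ∷ τ) i p)

incr₁-lookup : ∀ {t n} (σ : Vec ℕ n) {l} → t ≤ lookup σ l → Incr 1 t (toList σ)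
incr₁-lookup (x ∷ σ) {zero}  p = take p done
incr₁-lookup (x ∷ σ) {suc l} p = skip (incr₁-lookup σ p)

incr₂-lookup : ∀ {t n} (σ : Vec ℕ n) {k l} → k <ᶠ l → t ≤ lookup σ k → lookup σ k < lookup σ l → Incr 2 t (toList σ)
incr₂-lookup (x ∷ σ) {zero}  {suc l} _         p q = take p (incr₁-lookup σ q)
incr₂-lookup (x ∷ σ) {suc k} {suc l} (s≤s k<l) p q = skip (incr₂-lookup σ k<l p q)

incr₃-lookup : ∀ {t n} (σ : Vec ℕ n) {j k l} → j <ᶠ k → k <ᶠ l →
               t ≤ lookup σ j → lookup σ j < lookup σ k → lookup σ k < lookup σ l → Incr 3 t (toList σ)
incr₃-lookup (x ∷ σ) {zero}  {suc k} {suc l} _         (s≤s k<l) p q r = take p (incr₂-lookup σ k<l q r)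
incr₃-lookup (x ∷ σ) {suc j} {suc k} {suc l} (s≤s j<k) (s≤s k<l) p q r = skip (incr₃-lookup σ j<k k<l p q r)

contains1234⇒incr₄ : ∀ {n} (σ : Vec ℕ n) → Contains1234 σ → Incr 4 0 (toList σ)
contains1234⇒incr₄ (x ∷ σ) (zero , suc j , suc k , suc l , _ , s≤s j<k , s≤s k<l , p , q , r) =
  take z≤n (incr₃-lookup σ j<k k<l p q r)
contains1234⇒incr₄ (x ∷ σ) (suc i , suc j , suc k , suc l , s≤s i<j , s≤s j<k , s≤s k<l , p , q , r) =
  skip (contains1234⇒incr₄ σ (i , j , k , l , i<j , j<k , k<l , p , q , r))

lookup-incr₁ : ∀ {t n} (σ : Vec ℕ n) → Incr 1 t (toList σ) → ∃[ l ] t ≤ lookup σ l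
lookup-incr₁ (x ∷ σ) (take p _) = zero , p
lookup-incr₁ (x ∷ σ) (skip p) with lookup-incr₁ σ p
... | l , q = suc l , q

lookup-incr₂ : ∀ {t n} (σ : Vec ℕ n) → Incr 2 t (toList σ) →
               ∃[ k ] ∃[ l ] (k <ᶠ l × t ≤ lookup σ k × lookup σ k < lookup σ l)
lookup-incr₂ (x ∷ σ) (take p rest) with lookup-incr₁ σ rest
... | l , q = zero , suc l , s≤s z≤n , p , q
lookup-incr₂ (x ∷ σ) (skip p) with lookup-incr₂ σ p
... | k , l , k<l , q , r = suc k , suc l , s≤s k<l , q , r

lookup-incr₃ : ∀ {t n} (σ : Vec ℕ n) → Incr 3 t (toList σ) →
               ∃[ j ] ∃[ k ] ∃[ l ] (j <ᶠ k × k <ᶠ l × t ≤ lookup σ j × lookup σ j < lookup σ k × lookup σ k < lookup σ l)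
lookup-incr₃ (x ∷ σ) (take p rest) with lookup-incr₂ σ rest
... | k , l , k<l , q , r = zero , suc k , suc l , s≤s z≤n , s≤s k<l , p , q , r
lookup-incr₃ (x ∷ σ) (skip p) with lookup-incr₃ σ p
... | j , k , l , j<k , k<l , q , r , s = suc j , suc k , suc l , s≤s j<k , s≤s k<l , q , r , s

incr₄⇒contains1234 : ∀ {n} (σ : Vec ℕ n) → Incr 4 0 (toList σ) → Contains1234 σ
incr₄⇒contains1234 (x ∷ σ) (take _ rest) with lookup-incr₃ σ rest
... | j , k , l , j<k , k<l , p , q , r = zero , suc j , suc k , suc l , s≤s z≤n , s≤s j<k , s≤s k<l , p , q , r
incr₄⇒contains1234 (x ∷ σ) (skip p) with incr₄⇒contains1234 σ p
... | i , j , k , l , i<j , j<k , k<l , q , r , s = suc i , suc j , suc k , suc l , s≤s i<j , s≤s j<k , s≤s k<l , q , r , s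

[<ᵇ]-mono : ∀ z {x y} → x ≤ y → [ z <ᵇ x ] ≤ [ z <ᵇ y ]
[<ᵇ]-mono z {x} {y} x≤y with z <ᵇ x | <ᵇ-reflects-< z x | z <ᵇ y | <ᵇ-reflects-< z y
... | false | _        | _     | _        = z≤n
... | true  | _        | true  | _        = ≤-refl
... | true  | ofʸ z<x | false | ofⁿ z≮y = contradiction (<-≤-trans z<x x≤y) z≮y

below-mono-≤ : ∀ {x y} → x ≤ y → ∀ w → below x w ≤ below y w
below-mono-≤ x≤y []      = z≤n
below-mono-≤ x≤y (z ∷ w) = +-mono-≤ ([<ᵇ]-mono z x≤y) (below-mono-≤ x≤y w)

below-mono-< : ∀ {x y w} → x ∈ w → x < y → below x w < below y w
below-mono-< {x} {y} {z ∷ w} (here refl) x<y with x <ᵇ x | <ᵇ-reflects-< x x | x <ᵇ y | <ᵇ-reflects-< x y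
... | true  | ofʸ x<x | _     | _        = contradiction x<x (<-irrefl refl)
... | false | _        | true  | _        = s≤s (below-mono-≤ (<⇒≤ x<y) w)
... | false | _        | false | ofⁿ x≮y = contradiction x<y x≮y
below-mono-< {w = z ∷ w} (there x∈w) x<y = +-mono-≤-< ([<ᵇ]-mono z (<⇒≤ x<y)) (below-mono-< x∈w x<y)

incr-standardize : ∀ {k w} → Incr k 0 w → Incr k 0 (standardize w)
incr-standardize {w = w} =
  incr-map (λ x → suc (below x w)) (λ x∈w x<y → s≤s (below-mono-< x∈w x<y)) (All.tabulate id) (λ _ _ → z≤n)

below-map : ∀ (f : ℕ → ℕ) → (∀ {x y} → x < y ⇔ f x < f y) → ∀ x w → below (f x) (List.map f w) ≡ below x w
below-map f f-order x []      = refl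
below-map f f-order x (y ∷ w) = cong₂ _+_ indicator (below-map f f-order x w)
  where
  indicator : [ f y <ᵇ f x ] ≡ [ y <ᵇ x ]
  indicator with f y <ᵇ f x | <ᵇ-reflects-< (f y) (f x) | y <ᵇ x | <ᵇ-reflects-< y x
  ... | true  | _          | true  | _        = refl
  ... | false | _          | false | _        = refl
  ... | true  | ofʸ fy<fx  | false | ofⁿ y≮x = contradiction (Equivalence.from f-order fy<fx) y≮x
  ... | false | ofⁿ fy≮fx  | true  | ofʸ y<x = contradiction (Equivalence.to f-order y<x) fy≮fx

standardize-map : ∀ (f : ℕ → ℕ) → (∀ {x y} → x < y ⇔ f x < f y) →
                  ∀ w → standardize (List.map f w) ≡ standardize w
standardize-map f f-order w = trans (sym (List-map-∘ w)) (List-map-cong (λ x → cong suc (below-map f f-order x w)) w)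

-- 123-avoiding permutations and ballot numbers

Avoids123 : List ℕ → Set
Avoids123 w = ¬ Incr 3 0 w

AscentsFrom≤ : ℕ → List ℕ → Set
AscentsFrom≤ j w = ¬ Incr 2 (suc j) w

IsAv123 : (m : ℕ) → Vec ℕ m → Set
IsAv123 m σ = IsPermutation m σ × Avoids123 (toList σ)

Av123 : ℕ → Set
Av123 m = Refinement (Vec ℕ m) (IsAv123 m)

Av123Asc≤ : ℕ → ℕ → Set
Av123Asc≤ m j = Refinement (Vec ℕ m) (λ σ → IsAv123 m σ × AscentsFrom≤ j (toList σ))

-- Exactly the conditions under which v ∷ map (punchIn v) σ lies in Av123Asc≤ (suc m) j.
record Prependable (m j : ℕ) (σ : Vec ℕ m) (v : ℕ) : Set where
  field
    tail-av         : IsAv123 m σ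
    1≤head          : 1 ≤ v
    head≤           : v ≤ suc m
    no-ascent≥head  : ¬ Incr 2 v (toList σ)
    head-not-inside : ¬ (j < v × v ≤ m)
    tail-asc≤       : AscentsFrom≤ j (toList σ)
open Prependable

HeadTail : ℕ → ℕ → Set
HeadTail m j = Refinement (Vec ℕ m × ℕ) (λ (σ , v) → Prependable m j σ v)

prependable⇒cons : ∀ {m j σ v} → Prependable m j σ v →
          IsAv123 (suc m) (v ∷ map (punchIn v) σ) × AscentsFrom≤ j (toList (v ∷ map (punchIn v) σ))
prependable⇒cons {m} {j} {σ} {v} p =
    (perm-cons {σ = σ} (proj₁ (tail-av p)) (1≤head p) (head≤ p) , via-toList-map Avoids123 avoids)
  , via-toList-map (AscentsFrom≤ j) asc≤
  where
  via-toList-map : (R : List ℕ → Set) → R (v ∷ List.map (punchIn v) (toList σ)) → R (v ∷ toList (map (punchIn v) σ))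
  via-toList-map R = subst (λ w → R (v ∷ w)) (sym (toList-map (punchIn v) σ))
  from-punchIn : ∀ {k t} → Incr k t (List.map (punchIn v) (toList σ)) → Incr k (t ⊓ v) (toList σ)
  from-punchIn = incr-map⁻ (punchIn v) (punchIn-cancel-< v) (toList σ) (punchIn-cancel-≤ v)
  avoids : Avoids123 (v ∷ List.map (punchIn v) (toList σ))
  avoids (take _ q) = no-ascent≥head p (subst (λ t → Incr 2 t (toList σ)) (m≥n⇒m⊓n≡n (n≤1+n v)) (from-punchIn q))
  avoids (skip q)   = proj₂ (tail-av p) (from-punchIn q)
  asc≤ : AscentsFrom≤ j (v ∷ List.map (punchIn v) (toList σ))
  asc≤ (take j<v q) = head-not-inside p (j<v , v≤m)
    where
    v≤m : v ≤ m
    v≤m = subst (_≤ m) (+-identityʳ v) (incr-bound (All.map proj₂ (perm-range {σ = σ} (proj₁ (tail-av p))))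
            (subst (λ t → Incr 1 t (toList σ)) (m≥n⇒m⊓n≡n (n≤1+n v)) (from-punchIn q)))
  asc≤ (skip q) with incr-⊓ (from-punchIn q)
  ... | inj₁ asc = tail-asc≤ p asc
  ... | inj₂ asc = no-ascent≥head p asc

cons⇒prependable : ∀ {m j v} {τ : Vec ℕ m} → IsAv123 (suc m) (v ∷ τ) → AscentsFrom≤ j (v ∷ toList τ) →
            Prependable m j (map (punchOut v) τ) v
cons⇒prependable {m} {j} {v} {τ} (vτ-perm , avoids) asc≤ = record
  { tail-av         = perm-uncons {τ = τ} vτ-perm , λ q → avoids (skip (restore (λ _ → z≤n) q))
  ; 1≤head          = proj₁ v-range
  ; head≤           = proj₂ v-range
  ; no-ascent≥head  = λ q → avoids (take z≤n (restore punchIn-≥-suc q))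
  ; head-not-inside = λ (j<v , v≤m) → asc≤ (take j<v (any⇒incr₁ (Any.map (λ { refl → s≤s v≤m }) (max∈tail v≤m))))
  ; tail-asc≤       = λ q → asc≤ (skip (restore (λ {x} j<x → ≤-trans j<x (≤-punchIn v x)) q))
  }
  where
  v-range : 1 ≤ v × v ≤ suc m
  v-range = All.head (perm-range {σ = v ∷ τ} vτ-perm)
  restore : ∀ {k t t′} → (∀ {x} → t ≤ x → t′ ≤ punchIn v x) →
            Incr k t (toList (map (punchOut v) τ)) → Incr k t′ (toList τ)
  restore {k} {t} {t′} th q =
    subst (λ τ′ → Incr k t′ (toList τ′)) (map-punchIn-punchOut v τ (perm-head∉tail {τ = τ} vτ-perm))
      (subst (Incr k t′) (sym (toList-map (punchIn v) (map (punchOut v) τ)))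
        (incr-map-mono (punchIn v) (punchIn-mono-< v) th q))
  max∈tail : v ≤ m → Any (_≡ suc m) (toList τ)
  max∈tail v≤m = count≡1⇒∈ (suc m) (toList τ)
    (trans (sym (count-cons-≢ (toList τ) (λ v≡1+m → <-irrefl v≡1+m (s≤s v≤m)))) (vτ-perm (suc m) (s≤s z≤n) ≤-refl))

map-punchOut-punchIn : ∀ v {m} (σ : Vec ℕ m) → map (punchOut v) (map (punchIn v) σ) ≡ σ
map-punchOut-punchIn v σ =
  trans (sym (map-∘ (punchOut v) (punchIn v) σ)) (trans (map-cong (punchOut-punchIn v) σ) (map-id σ))

Av123Asc≤-suc↔HeadTail : ∀ m j → Av123Asc≤ (suc m) j ↔ HeadTail m j
Av123Asc≤-suc↔HeadTail m j = refinement-↔ (Vec-≡-dec _≟_) (×-≡-dec (Vec-≡-dec _≟_) _≟_) uncons cons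
  (λ { {v ∷ τ} (av , asc) → cons⇒prependable {τ = τ} av asc })
  prependable⇒cons
  (λ { {σ , v} _ → cong (_, v) (map-punchOut-punchIn v σ) })
  (λ { {v ∷ τ} (av , _) → cong (v ∷_) (map-punchIn-punchOut v τ (perm-head∉tail {τ = τ} (proj₁ av))) })
  where
  uncons : Vec ℕ (suc m) → Vec ℕ m × ℕ
  uncons (v ∷ τ) = map (punchOut v) τ , v
  cons : Vec ℕ m × ℕ → Vec ℕ (suc m)
  cons (σ , v) = v ∷ map (punchIn v) σ

head≡suc : ∀ {m j v} → j < v → v ≤ suc m → ¬ (j < v × v ≤ m) → v ≡ suc m
head≡suc j<v v≤1+m not-inside = ≤-antisym v≤1+m (≰⇒> λ v≤m → not-inside (j<v , v≤m))

HeadTail-0↔Av123Asc≤ : ∀ m → HeadTail m 0 ↔ Av123Asc≤ m 0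
HeadTail-0↔Av123Asc≤ m = refinement-↔ (×-≡-dec (Vec-≡-dec _≟_) _≟_) (Vec-≡-dec _≟_) proj₁ (_, suc m)
  (λ p → tail-av p , tail-asc≤ p)
  (λ (av , asc) → record
     { tail-av = av ; 1≤head = s≤s z≤n ; head≤ = ≤-refl
     ; no-ascent≥head = λ q → asc (incr-lower (s≤s z≤n) q)
     ; head-not-inside = λ (_ , 1+m≤m) → 1+n≰n 1+m≤m
     ; tail-asc≤ = asc })
  (λ _ → refl)
  (λ { {σ , v} p → cong (σ ,_) (sym (head≡suc (1≤head p) (head≤ p) (head-not-inside p))) })

module _ {m j : ℕ} (j<m : suc j ≤ m) where

  private
    Lower : Vec ℕ m × ℕ → Set
    Lower (σ , v) = v ≢ suc j × AscentsFrom≤ j (toList σ)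

    lower? : Decidable Lower
    lower? (σ , v) = ¬? (v ≟ suc j) ×-dec ¬? (incr? 2 (suc j) (toList σ))

    lower↔ : Refinement (Vec ℕ m × ℕ) (λ (σ , v) → Prependable m (suc j) σ v × Lower (σ , v)) ↔ HeadTail m j
    lower↔ = refinement-↔ (×-≡-dec (Vec-≡-dec _≟_) _≟_) (×-≡-dec (Vec-≡-dec _≟_) _≟_) id id
      (λ (p , v≢1+j , asc) → record
         { tail-av = tail-av p ; 1≤head = 1≤head p ; head≤ = head≤ p ; no-ascent≥head = no-ascent≥head p
         ; head-not-inside = λ (j<v , v≤m) → head-not-inside p (≤∧≢⇒< j<v (λ 1+j≡v → v≢1+j (sym 1+j≡v)) , v≤m)
         ; tail-asc≤ = asc })
      (λ p → record
         { tail-av = tail-av p ; 1≤head = 1≤head p ; head≤ = head≤ p ; no-ascent≥head = no-ascent≥head p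
         ; head-not-inside = λ (1+j<v , v≤m) → head-not-inside p (<⇒≤ 1+j<v , v≤m)
         ; tail-asc≤ = λ q → tail-asc≤ p (incr-lower (n≤1+n _) q) }
         , (λ { refl → head-not-inside p (≤-refl , j<m) }) , tail-asc≤ p)
      (λ _ → refl) (λ _ → refl)

    -- A tail with an ascent above j can only follow the head m + 1; any other tail follows j + 1.
    headFor : Vec ℕ m → ℕ
    headFor σ with incr? 2 (suc j) (toList σ)
    ... | yes _ = suc m
    ... | no  _ = suc j

    headFor-fits : ∀ {σ} → IsAv123 m σ × AscentsFrom≤ (suc j) (toList σ) →
                   Prependable m (suc j) σ (headFor σ) × ¬ Lower (σ , headFor σ)
    headFor-fits {σ} (av , asc) with incr? 2 (suc j) (toList σ)
    ... | yes asc-j = record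
          { tail-av = av ; 1≤head = s≤s z≤n ; head≤ = ≤-refl
          ; no-ascent≥head = λ q → asc (incr-lower (s≤s j<m) q)
          ; head-not-inside = λ (_ , 1+m≤m) → 1+n≰n 1+m≤m
          ; tail-asc≤ = asc }
        , λ (_ , no-asc-j) → no-asc-j asc-j
    ... | no no-asc-j = record
          { tail-av = av ; 1≤head = s≤s z≤n ; head≤ = s≤s (<⇒≤ j<m)
          ; no-ascent≥head = no-asc-j
          ; head-not-inside = λ (1+j<1+j , _) → <-irrefl refl 1+j<1+j
          ; tail-asc≤ = asc }
        , λ (1+j≢1+j , _) → 1+j≢1+j refl

    headFor-unique : ∀ {σ v} → Prependable m (suc j) σ v × ¬ Lower (σ , v) → headFor σ ≡ v
    headFor-unique {σ} {v} (p , not-lower) with incr? 2 (suc j) (toList σ)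
    ... | yes asc-j =
      sym (head≡suc (≰⇒> λ v≤1+j → no-ascent≥head p (incr-lower v≤1+j asc-j)) (head≤ p) (head-not-inside p))
    ... | no no-asc-j = sym (decidable-stable (v ≟ suc j) (λ v≢1+j → not-lower (v≢1+j , no-asc-j)))

    upper↔ : Refinement (Vec ℕ m × ℕ) (λ (σ , v) → Prependable m (suc j) σ v × ¬ Lower (σ , v)) ↔
             Av123Asc≤ m (suc j)
    upper↔ = refinement-↔ (×-≡-dec (Vec-≡-dec _≟_) _≟_) (Vec-≡-dec _≟_) proj₁ (λ σ → σ , headFor σ)
      (λ (p , _) → tail-av p , tail-asc≤ p) headFor-fits
      (λ _ → refl) (λ { {σ , v} p → cong (σ ,_) (headFor-unique p) })

  HeadTail-suc↔⊎ : HeadTail m (suc j) ↔ (HeadTail m j ⊎ Av123Asc≤ m (suc j))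
  HeadTail-suc↔⊎ = ↔-trans (refinement-split lower?) (lower↔ ⊎-↔ upper↔)

Av123↔Av123Asc≤ : ∀ {m j} → m ≤ suc j → Av123 m ↔ Av123Asc≤ m j
Av123↔Av123Asc≤ {m} {j} m≤1+j = refinement-↔ (Vec-≡-dec _≟_) (Vec-≡-dec _≟_) id id
  (λ { {σ} (perm , avoids) → (perm , avoids) , λ q →
        1+n≰n (≤-trans (≤-reflexive (+-comm 1 (suc j)))
                (≤-trans (incr-bound (All.map proj₂ (perm-range {σ = σ} perm)) q) m≤1+j)) })
  proj₁ (λ _ → refl) (λ _ → refl)

Av123Asc≤-0↔Fin1 : Av123Asc≤ 0 0 ↔ Fin 1
Av123Asc≤-0↔Fin1 = mk↔ₛ′ (λ _ → zero)
  (λ _ → [] , Irr.[ ((λ _ 1≤k k≤0 → contradiction (≤-trans 1≤k k≤0) λ ()) , λ ()) , (λ ()) ])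
  (λ { zero → refl }) (λ { ([] , _) → value-injective refl })

-- ballot j d counts the 123-avoiding permutations of length j + d whose ascents all start at values ≤ j.
ballot : ℕ → ℕ → ℕ
ballot zero    d       = 1
ballot (suc j) zero    = ballot j 1
ballot (suc j) (suc d) = ballot j (suc (suc d)) + ballot (suc j) d

Av123Asc≤↔Fin-ballot : ∀ j d → Av123Asc≤ (j + d) j ↔ Fin (ballot j d)
Av123Asc≤↔Fin-ballot zero    zero    = Av123Asc≤-0↔Fin1
Av123Asc≤↔Fin-ballot zero    (suc d) =
  ↔-trans (Av123Asc≤-suc↔HeadTail d 0) (↔-trans (HeadTail-0↔Av123Asc≤ d) (Av123Asc≤↔Fin-ballot zero d))
Av123Asc≤↔Fin-ballot (suc j) zero    =
  ↔-trans (↔-sym (Av123↔Av123Asc≤ (m≤n⇒m≤1+n (≤-reflexive (+-identityʳ (suc j))))))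
    (↔-trans (Av123↔Av123Asc≤ (≤-reflexive (+-identityʳ (suc j))))
      (subst (λ m → Av123Asc≤ m j ↔ Fin (ballot j 1)) (trans (+-comm j 1) (sym (+-identityʳ (suc j))))
        (Av123Asc≤↔Fin-ballot j 1)))
Av123Asc≤↔Fin-ballot (suc j) (suc d) =
  ↔-trans (Av123Asc≤-suc↔HeadTail (j + suc d) (suc j))
    (↔-trans (HeadTail-suc↔⊎ (≤-trans (s≤s (m≤m+n j d)) (≤-reflexive (sym (+-suc j d)))))
      (↔-trans (earlier (Av123Asc≤↔Fin-ballot j (suc (suc d))) ⊎-↔ later (Av123Asc≤↔Fin-ballot (suc j) d))
        (↔-sym +↔⊎)))
  where
  earlier : Av123Asc≤ (j + suc (suc d)) j ↔ Fin (ballot j (suc (suc d))) →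
            HeadTail (j + suc d) j ↔ Fin (ballot j (suc (suc d)))
  earlier count = ↔-trans (↔-sym (Av123Asc≤-suc↔HeadTail (j + suc d) j))
                    (subst (λ m → Av123Asc≤ m j ↔ Fin (ballot j (suc (suc d)))) (+-suc j (suc d)) count)
  later : Av123Asc≤ (suc j + d) (suc j) ↔ Fin (ballot (suc j) d) →
          Av123Asc≤ (j + suc d) (suc j) ↔ Fin (ballot (suc j) d)
  later = subst (λ m → Av123Asc≤ m (suc j) ↔ Fin (ballot (suc j) d)) (sym (+-suc j d))

Av123↔Fin-ballot : ∀ m → Av123 m ↔ Fin (ballot m 0)
Av123↔Fin-ballot m = ↔-trans (Av123↔Av123Asc≤ (n≤1+n m))
  (subst (λ m′ → Av123Asc≤ m′ m ↔ Fin (ballot m 0)) (+-identityʳ m) (Av123Asc≤↔Fin-ballot m 0))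

-- Partial permutations with one hole

withHole : ∀ {m} → Fin (suc m) → Vec ℕ m → Vec (Maybe ℕ) (suc m)
withHole i σ = insertAt (map just σ) i nothing

holes-map-just : ∀ {m} (σ : Vec ℕ m) → holes (toList (map just σ)) ≡ 0
holes-map-just []      = refl
holes-map-just (x ∷ σ) = holes-map-just σ

catMaybes-map-just : ∀ {m} (σ : Vec ℕ m) → catMaybes (toList (map just σ)) ≡ toList σ
catMaybes-map-just []      = refl
catMaybes-map-just (x ∷ σ) = cong (x ∷_) (catMaybes-map-just σ)

holes-withHole : ∀ {m} i (σ : Vec ℕ m) → holes (toList (withHole i σ)) ≡ 1
holes-withHole zero    σ       = cong suc (holes-map-just σ)
holes-withHole (suc i) (x ∷ σ) = holes-withHole i σ

catMaybes-withHole : ∀ {m} i (σ : Vec ℕ m) → catMaybes (toList (withHole i σ)) ≡ toList σ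
catMaybes-withHole zero    σ       = catMaybes-map-just σ
catMaybes-withHole (suc i) (x ∷ σ) = cong (x ∷_) (catMaybes-withHole i σ)

restrict-map-just : ∀ {m} (τ : Vec ℕ m) (σ : Vec ℕ m) → restrict τ (map just σ) ≡ toList τ
restrict-map-just []      []      = refl
restrict-map-just (x ∷ τ) (_ ∷ σ) = cong (x ∷_) (restrict-map-just τ σ)

restrict-withHole : ∀ {m} (τ : Vec ℕ (suc m)) i (σ : Vec ℕ m) → restrict τ (withHole i σ) ≡ toList (removeAt τ i)
restrict-withHole (x ∷ τ)     zero    σ       = restrict-map-just τ σ
restrict-withHole (x ∷ y ∷ τ) (suc i) (_ ∷ σ) = cong (x ∷_) (restrict-withHole (y ∷ τ) i σ)

-- The hole can always be filled so as to lengthen a given increasing subsequence: at the hole, use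
-- the smallest value the subsequence still allows there.
incr-insertAt : ∀ {b k t m} (σ : Vec ℕ m) i → All (_≤ b) (toList σ) → t ≤ suc b → Incr k t (toList σ) →
                ∃[ v ] (t ≤ v × v ≤ suc b × Incr (suc k) t (toList (insertAt (map (punchIn v) σ) i v)))
incr-insertAt {t = t} σ zero _ t≤1+b p =
  t , ≤-refl , t≤1+b , take ≤-refl (subst (Incr _ (suc t)) (sym (toList-map (punchIn t) σ))
                                      (incr-map-mono (punchIn t) (punchIn-mono-< t) punchIn-≥-suc p))
incr-insertAt (x ∷ σ) (suc i) (_ ∷ σ≤b) t≤1+b done with incr-insertAt σ i σ≤b t≤1+b done
... | v , t≤v , v≤1+b , q = v , t≤v , v≤1+b , skip q
incr-insertAt (x ∷ σ) (suc i) (_ ∷ σ≤b) t≤1+b (skip p) with incr-insertAt σ i σ≤b t≤1+b p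
... | v , t≤v , v≤1+b , q = v , t≤v , v≤1+b , skip q
incr-insertAt {t = t} (x ∷ σ) (suc i) (x≤b ∷ σ≤b) _ (take t≤x p) with incr-insertAt σ i σ≤b (s≤s x≤b) p
... | v , x<v , v≤1+b , q =
  v , ≤-trans t≤x (<⇒≤ x<v) , v≤1+b , subst (λ y → Incr _ t (y ∷ _)) (sym (punchIn-< x<v)) (take t≤x q)

insertAt-extends : ∀ {m v} (σ : Vec ℕ m) i → IsPermutation m σ → 1 ≤ v → v ≤ suc m →
               IsExtension (withHole i σ) (insertAt (map (punchIn v) σ) i v)
insertAt-extends {m} {v} σ i σ-perm 1≤v v≤1+m = perm , std
  where
  τ : Vec ℕ (suc m)
  τ = insertAt (map (punchIn v) σ) i v
  perm : IsPermutation (suc m) τ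
  perm k 1≤k k≤1+m =
    trans (count-insertAt k (map (punchIn v) σ) i v) (perm-cons {σ = σ} σ-perm 1≤v v≤1+m k 1≤k k≤1+m)
  std : standardize (restrict τ (withHole i σ)) ≡ catMaybes (toList (withHole i σ))
  std = begin
    standardize (restrict τ (withHole i σ))
      ≡⟨ cong standardize (restrict-withHole τ i σ) ⟩
    standardize (toList (removeAt τ i))
      ≡⟨ cong (λ ρ → standardize (toList ρ)) (removeAt-insertAt (map (punchIn v) σ) i v) ⟩
    standardize (toList (map (punchIn v) σ))
      ≡⟨ cong standardize (toList-map (punchIn v) σ) ⟩
    standardize (List.map (punchIn v) (toList σ))
      ≡⟨ standardize-map (punchIn v) (mk⇔ (punchIn-mono-< v) (punchIn-cancel-< v)) (toList σ) ⟩
    standardize (toList σ)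
      ≡⟨ standardize-perm σ-perm ⟩
    toList σ
      ≡⟨ catMaybes-withHole i σ ⟨
    catMaybes (toList (withHole i σ))                  ∎
    where open ≡-Reasoning

avoids⇒ppAvoids : ∀ {m} i (σ : Vec ℕ m) → Avoids123 (toList σ) → PPAvoids1234 (withHole i σ)
avoids⇒ppAvoids i σ avoids τ (_ , std) τ⊇1234 =
  avoids (subst (Incr 3 0) (trans std (catMaybes-withHole i σ))
    (incr-standardize (subst (Incr 3 0) (sym (restrict-withHole τ i σ))
      (incr-removeAt τ i (contains1234⇒incr₄ τ τ⊇1234)))))

ppAvoids⇒avoids : ∀ {m} i (σ : Vec ℕ m) → IsPermutation m σ → PPAvoids1234 (withHole i σ) → Avoids123 (toList σ)
ppAvoids⇒avoids {m} i σ σ-perm pp-avoids σ⊇123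
  with incr-insertAt σ i (All.map proj₂ range) (s≤s z≤n) (incr-rebase (All.map proj₁ range) σ⊇123)
  where
  range : All (λ x → 1 ≤ x × x ≤ m) (toList σ)
  range = perm-range {σ = σ} σ-perm
... | v , 1≤v , v≤1+m , τ⊇1234 =
  pp-avoids (insertAt (map (punchIn v) σ) i v) (insertAt-extends σ i σ-perm 1≤v v≤1+m)
    (incr₄⇒contains1234 _ (incr-lower z≤n τ⊇1234))

-- The position of the first hole and the other entries; junk unless π has exactly one hole.
splitHole : ∀ {m} → Vec (Maybe ℕ) (suc m) → Fin (suc m) × Vec ℕ m
splitHole (nothing ∷ π)         = zero , map (fromMaybe 0) π
splitHole {zero}  (just _ ∷ []) = zero , []
splitHole {suc m} (just x ∷ π)  = Product.map suc (x ∷_) (splitHole π)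

splitHole-withHole : ∀ {m} i (σ : Vec ℕ m) → splitHole (withHole i σ) ≡ (i , σ)
splitHole-withHole zero    σ       = cong (zero ,_) (trans (sym (map-∘ (fromMaybe 0) just σ)) (map-id σ))
splitHole-withHole {suc m} (suc i) (x ∷ σ) = cong (Product.map suc (x ∷_)) (splitHole-withHole i σ)

map-just-fromMaybe : ∀ {m} (π : Vec (Maybe ℕ) m) → holes (toList π) ≡ 0 → map just (map (fromMaybe 0) π) ≡ π
map-just-fromMaybe []           _ = refl
map-just-fromMaybe (just x ∷ π) h = cong (just x ∷_) (map-just-fromMaybe π h)

withHole-splitHole : ∀ {m} (π : Vec (Maybe ℕ) (suc m)) → holes (toList π) ≡ 1 → uncurry withHole (splitHole π) ≡ π
withHole-splitHole (nothing ∷ π)         h = cong (nothing ∷_) (map-just-fromMaybe π (suc-injective h))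
withHole-splitHole {zero}  (just x ∷ []) ()
withHole-splitHole {suc m} (just x ∷ π)  h = cong (just x ∷_) (withHole-splitHole π h)

withHole-pp⇒av : ∀ {m} i (σ : Vec ℕ m) →
                 IsPartialPerm1 (suc m) (withHole i σ) × PPAvoids1234 (withHole i σ) → IsAv123 m σ
withHole-pp⇒av i σ ((_ , counts) , pp-avoids) = σ-perm , ppAvoids⇒avoids i σ σ-perm pp-avoids
  where
  σ-perm : IsPermutation _ σ
  σ-perm k 1≤k k≤m = trans (cong (count k) (sym (catMaybes-withHole i σ))) (counts k 1≤k k≤m)

av⇒withHole-pp : ∀ {m} i (σ : Vec ℕ m) → IsAv123 m σ →
                 IsPartialPerm1 (suc m) (withHole i σ) × PPAvoids1234 (withHole i σ)
av⇒withHole-pp i σ (σ-perm , avoids) =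
    (holes-withHole i σ , λ k 1≤k k≤m → trans (cong (count k) (catMaybes-withHole i σ)) (σ-perm k 1≤k k≤m))
  , avoids⇒ppAvoids i σ avoids

PP1234↔Fin×Av123 : ∀ m → PP1234 (suc m) ↔ (Fin (suc m) × Av123 m)
PP1234↔Fin×Av123 m = ↔-trans
  (refinement-↔ (Vec-≡-dec (Maybe-≡-dec _≟_)) (×-≡-dec Fin-≟ (Vec-≡-dec _≟_)) splitHole (uncurry withHole)
    (λ {π} ((one-hole , counts) , pp-avoids) → uncurry withHole-pp⇒av (splitHole π)
       (subst (λ π′ → IsPartialPerm1 (suc m) π′ × PPAvoids1234 π′) (sym (withHole-splitHole π one-hole))
          ((one-hole , counts) , pp-avoids)))
    (λ { {i , σ} → av⇒withHole-pp i σ })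
    (λ { {i , σ} _ → splitHole-withHole i σ })
    (λ { {π} ((one-hole , _) , _) → withHole-splitHole π one-hole }))
  refinement-proj₂↔×

-- Balanced lattice paths

module _ where

  open import Data.Integer using (ℤ; +_; -[1+_]) renaming (_+_ to _+ℤ_)
  import Data.Integer.Properties as ℤ
  open import Data.Integer.Tactic.RingSolver using (solve-∀)

  ups : ∀ {L} → Vec Step L → ℕ
  ups []         = 0
  ups (up ∷ s)   = suc (ups s)
  ups (down ∷ s) = ups s

  height+length : ∀ {L} (s : Vec Step L) → height s +ℤ + L ≡ + (ups s + ups s)
  height+length []         = refl
  height+length {suc L} (up ∷ s) = begin
    (+ 1 +ℤ height s) +ℤ (+ 1 +ℤ + L)
      ≡⟨ shift (height s) (+ L) ⟩
    (height s +ℤ + L) +ℤ + 2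
      ≡⟨ cong (_+ℤ + 2) (height+length s) ⟩
    + (ups s + ups s + 2)
      ≡⟨ cong +_ (trans (+-comm (ups s + ups s) 2) (cong suc (sym (+-suc (ups s) (ups s))))) ⟩
    + (suc (ups s) + suc (ups s))       ∎
    where
    open ≡-Reasoning
    shift : ∀ h l → (+ 1 +ℤ h) +ℤ (+ 1 +ℤ l) ≡ (h +ℤ l) +ℤ + 2
    shift = solve-∀
  height+length {suc L} (down ∷ s) = trans (shift (height s) (+ L)) (height+length s)
    where
    shift : ∀ h l → (-[1+ 0 ] +ℤ h) +ℤ (+ 1 +ℤ l) ≡ h +ℤ l
    shift = solve-∀

  +-double-injective : ∀ {a b} → a + a ≡ b + b → a ≡ b
  +-double-injective {a} {b} eq = *-cancelˡ-≡ a b 2 (begin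
    2 * a        ≡⟨ cong (λ x → a + x) (+-identityʳ a) ⟩
    a + a        ≡⟨ eq ⟩
    b + b        ≡⟨ cong (λ x → b + x) (+-identityʳ b) ⟨
    2 * b        ∎)
    where open ≡-Reasoning

  balanced⇒ups≡half : ∀ {m} (s : Vec Step (m + m)) → height s ≡ + 0 → ups s ≡ m
  balanced⇒ups≡half {m} s h≡0 =
    +-double-injective (ℤ.+-injective (trans (sym (height+length s)) (cong (_+ℤ + (m + m)) h≡0)))

  ups≡half⇒balanced : ∀ {m} (s : Vec Step (m + m)) → ups s ≡ m → height s ≡ + 0
  ups≡half⇒balanced {m} s u≡m =
    ∙-cancelʳ (+ (m + m)) (height s) (+ 0) (trans (height+length s) (cong (λ u → + (u + u)) u≡m))
    where open import Algebra.Properties.AbelianGroup ℤ.+-0-abelianGroup using (∙-cancelʳ)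

  PathsWithUps : ℕ → ℕ → Set
  PathsWithUps L u = Refinement (Vec Step L) (λ s → ups s ≡ u)

  PathsWithUps↔Fin : ∀ L u → PathsWithUps L u ↔ Fin (L C u)
  PathsWithUps↔Fin zero    zero    =
    mk↔ₛ′ (λ _ → zero) (λ _ → [] , Irr.[ refl ]) (λ { zero → refl }) (λ { ([] , _) → value-injective refl })
  PathsWithUps↔Fin zero    (suc u) =
    ↔-trans (mk↔ₛ′ (λ { ([] , Irr.[ () ]) }) (λ ()) (λ ()) λ { ([] , Irr.[ () ]) }) (↔-sym 0↔⊥)
  PathsWithUps↔Fin (suc L) zero    =
    ↔-trans (mk↔ₛ′ tail (λ (s , p) → down ∷ s , p) (λ _ → refl) tail-cons) (PathsWithUps↔Fin L zero)
    where
    tail : PathsWithUps (suc L) zero → PathsWithUps L zero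
    tail ((down ∷ s) , p) = s , p
    tail-cons : ∀ s → (down ∷ Refinement.value (tail s) , Refinement.proof (tail s)) ≡ s
    tail-cons ((down ∷ s) , p) = refl
  PathsWithUps↔Fin (suc L) (suc u) = ↔-trans (mk↔ₛ′ split join split∘join join∘split)
    (↔-trans (PathsWithUps↔Fin L u ⊎-↔ PathsWithUps↔Fin L (suc u))
      (subst (λ c → (Fin (L C u) ⊎ Fin (L C suc u)) ↔ Fin c) (nCk+nC[k+1]≡[n+1]C[k+1] L u) (↔-sym +↔⊎)))
    where
    split : PathsWithUps (suc L) (suc u) → PathsWithUps L u ⊎ PathsWithUps L (suc u)
    split ((up ∷ s)   , p) = inj₁ (s , Irr.map suc-injective p)
    split ((down ∷ s) , p) = inj₂ (s , p)
    join : PathsWithUps L u ⊎ PathsWithUps L (suc u) → PathsWithUps (suc L) (suc u)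
    join (inj₁ (s , p)) = (up ∷ s) , Irr.map (cong suc) p
    join (inj₂ (s , p)) = (down ∷ s) , p
    split∘join : ∀ x → split (join x) ≡ x
    split∘join (inj₁ _) = refl
    split∘join (inj₂ _) = refl
    join∘split : ∀ x → join (split x) ≡ x
    join∘split ((up ∷ _)   , _) = refl
    join∘split ((down ∷ _) , _) = refl

  LatticePaths↔Fin : ∀ m → LatticePaths (suc m) ↔ Fin ((m + m) C m)
  LatticePaths↔Fin m =
    subst (λ L → Refinement (Vec Step L) (λ s → height s ≡ + 0) ↔ Fin ((m + m) C m)) (sym length≡)
    (↔-trans (refinement-↔ (Vec-≡-dec step-≟) (Vec-≡-dec step-≟) id id
               (λ {s} → balanced⇒ups≡half s) (λ {s} → ups≡half⇒balanced s) (λ _ → refl) (λ _ → refl))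
      (PathsWithUps↔Fin (m + m) m))
    where
    length≡ : 2 * suc m ∸ 2 ≡ m + m
    length≡ = cong (_∸ 1) (trans (cong (λ x → m + x) (+-identityʳ (suc m))) (+-suc m m))
    step-≟ : (a b : Step) → Dec (a ≡ b)
    step-≟ up   up   = yes refl
    step-≟ up   down = no λ ()
    step-≟ down up   = no λ ()
    step-≟ down down = yes refl

-- Binomial coefficients and the ballot formula

pascal : ∀ n k → suc n C suc k ≡ n C k + n C suc k
pascal n k = sym (nCk+nC[k+1]≡[n+1]C[k+1] n k)

C-absorption : ∀ n k → suc k * (suc n C suc k) ≡ suc n * (n C k)
C-absorption n       zero    = trans (*-identityˡ (suc n C 1)) (trans (nC1≡n (suc n)) (sym (*-identityʳ (suc n))))
C-absorption zero    (suc k) =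
  trans (cong (suc (suc k) *_) (k>n⇒nCk≡0 {1} {suc (suc k)} (s≤s (s≤s z≤n)))) (*-zeroʳ (suc (suc k)))
C-absorption (suc n) (suc k) = begin
  suc (suc k) * (suc (suc n) C suc (suc k))
    ≡⟨ cong (suc (suc k) *_) (pascal (suc n) (suc k)) ⟩
  suc (suc k) * (suc n C suc k + suc n C suc (suc k))
    ≡⟨ distrib (suc k) (suc n C suc k) (suc n C suc (suc k)) ⟩
  (suc k * (suc n C suc k) + suc n C suc k) + suc (suc k) * (suc n C suc (suc k))
    ≡⟨ cong₂ (λ x y → (x + suc n C suc k) + y) (C-absorption n k) (C-absorption n (suc k)) ⟩
  (suc n * (n C k) + suc n C suc k) + suc n * (n C suc k)
    ≡⟨ collect (suc n) (n C k) (n C suc k) (suc n C suc k) ⟩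
  suc n C suc k + suc n * (n C k + n C suc k)
    ≡⟨ cong (λ x → suc n C suc k + suc n * x) (pascal n k) ⟨
  suc (suc n) * (suc n C suc k)
    ∎
  where
  open ≡-Reasoning
  distrib : ∀ k x y → suc k * (x + y) ≡ (k * x + x) + suc k * y
  distrib = ℕ-Solver.solve-∀
  collect : ∀ n a b c → (n * a + c) + n * b ≡ c + n * (a + b)
  collect = ℕ-Solver.solve-∀

C-absorption′ : ∀ k r → suc k * ((k + r) C suc k) ≡ r * ((k + r) C k)
C-absorption′ k r = +-cancelʳ-≡ (suc k * ((k + r) C k)) _ _ (begin
  suc k * ((k + r) C suc k) + suc k * ((k + r) C k)
    ≡⟨ *-distribˡ-+ (suc k) ((k + r) C suc k) ((k + r) C k) ⟨
  suc k * ((k + r) C suc k + (k + r) C k)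
    ≡⟨ cong (suc k *_) (trans (+-comm ((k + r) C suc k) ((k + r) C k)) (sym (pascal (k + r) k))) ⟩
  suc k * (suc (k + r) C suc k)
    ≡⟨ C-absorption (k + r) k ⟩
  suc (k + r) * ((k + r) C k)
    ≡⟨ cong (_* ((k + r) C k)) (trans (cong suc (+-comm k r)) (sym (+-suc r k))) ⟩
  (r + suc k) * ((k + r) C k)
    ≡⟨ *-distribʳ-+ ((k + r) C k) r (suc k) ⟩
  r * ((k + r) C k) + suc k * ((k + r) C k)          ∎)
  where open ≡-Reasoning

-- The induction step of ballot-formula, with a = C(n, j) and b = C(n, j + 1) for n = 2j + d + 2.
ballot-step : ∀ j d {a b x y} → suc j * b ≡ suc (suc (j + d)) * a →
              suc (j + suc (suc d)) * x ≡ suc (suc (suc d)) * a → suc (suc j + d) * y ≡ suc d * b →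
              suc (suc j + suc d) * (x + y) ≡ suc (suc d) * (a + b)
ballot-step j d {a} {b} {x} {y} absorb hx hy = *-cancelˡ-≡ _ _ K (begin
  K * (suc (suc j + suc d) * (x + y))
    ≡⟨ expand j d x y ⟩
  K * (suc (j + suc (suc d)) * x) + suc (suc j + suc d) * (suc (suc j + d) * y)
    ≡⟨ cong₂ (λ p q → K * p + suc (suc j + suc d) * q) hx hy ⟩
  K * (suc (suc (suc d)) * a) + suc (suc j + suc d) * (suc d * b)
    ≡⟨ split j d a b ⟩
  (suc (suc d) * (K * a) + K * a) + suc (suc j + suc d) * (suc d * b)
    ≡⟨ cong (λ p → (suc (suc d) * (K * a) + p) + suc (suc j + suc d) * (suc d * b)) absorb ⟨
  (suc (suc d) * (K * a) + suc j * b) + suc (suc j + suc d) * (suc d * b)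
    ≡⟨ collect j d a b ⟩
  K * (suc (suc d) * (a + b))                                                       ∎)
  where
  open ≡-Reasoning
  K : ℕ
  K = suc (suc (j + d))
  expand : ∀ j d x y → suc (suc (j + d)) * (suc (suc j + suc d) * (x + y)) ≡
                       suc (suc (j + d)) * (suc (j + suc (suc d)) * x) + suc (suc j + suc d) * (suc (suc j + d) * y)
  expand = ℕ-Solver.solve-∀
  split : ∀ j d a b → suc (suc (j + d)) * (suc (suc (suc d)) * a) + suc (suc j + suc d) * (suc d * b) ≡
                      (suc (suc d) * (suc (suc (j + d)) * a) + suc (suc (j + d)) * a) + suc (suc j + suc d) * (suc d * b)
  split = ℕ-Solver.solve-∀
  collect : ∀ j d a b → (suc (suc d) * (suc (suc (j + d)) * a) + suc j * b) + suc (suc j + suc d) * (suc d * b) ≡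
                        suc (suc (j + d)) * (suc (suc d) * (a + b))
  collect = ℕ-Solver.solve-∀

ballot-formula : ∀ j d → suc (j + d) * ballot j d ≡ suc d * ((j + j + d) C j)
ballot-formula zero    d       = refl
ballot-formula (suc j) zero    = begin
  suc (suc j + 0) * ballot j 1
    ≡⟨ cong (λ n → suc n * ballot j 1) (trans (+-identityʳ (suc j)) (+-comm 1 j)) ⟩
  suc (j + 1) * ballot j 1
    ≡⟨ ballot-formula j 1 ⟩
  2 * ((j + j + 1) C j)
    ≡⟨ cong (λ n → 2 * (n C j)) (+-comm (j + j) 1) ⟩
  2 * (suc (j + j) C j)
    ≡⟨ cong (suc (j + j) C j +_) (+-identityʳ _) ⟩
  suc (j + j) C j + suc (j + j) C j
    ≡⟨ cong (suc (j + j) C j +_) middle-symmetric ⟩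
  suc (j + j) C j + suc (j + j) C suc j
    ≡⟨ pascal (suc (j + j)) j ⟨
  suc (suc (j + j)) C suc j
    ≡⟨ cong (λ n → suc n C suc j) (trans (sym (+-suc j j)) (sym (+-identityʳ (j + suc j)))) ⟩
  suc (j + suc j + 0) C suc j
    ≡⟨ *-identityˡ _ ⟨
  1 * ((suc j + suc j + 0) C suc j)     ∎
  where
  open ≡-Reasoning
  middle-symmetric : suc (j + j) C j ≡ suc (j + j) C suc j
  middle-symmetric = trans (cong (suc (j + j) C_) (sym (m+n∸m≡n (suc j) j))) (sym (nCk≡nC[n∸k] (s≤s (m≤m+n j j))))
ballot-formula (suc j) (suc d) = step (ballot-formula j (suc (suc d))) (ballot-formula (suc j) d)
  where
  N : ℕ
  N = j + suc j + suc d
  e₁ : ∀ j d → j + suc (suc (j + d)) ≡ j + suc j + suc d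
  e₁ = ℕ-Solver.solve-∀
  e₂ : ∀ j d → j + j + suc (suc d) ≡ j + suc j + suc d
  e₂ = ℕ-Solver.solve-∀
  e₃ : ∀ j d → suc j + suc j + d ≡ j + suc j + suc d
  e₃ = ℕ-Solver.solve-∀
  absorb : suc j * (N C suc j) ≡ suc (suc (j + d)) * (N C j)
  absorb = subst (λ n → suc j * (n C suc j) ≡ suc (suc (j + d)) * (n C j)) (e₁ j d) (C-absorption′ j (suc (suc (j + d))))
  step : suc (j + suc (suc d)) * ballot j (suc (suc d)) ≡ suc (suc (suc d)) * ((j + j + suc (suc d)) C j) →
         suc (suc j + d) * ballot (suc j) d ≡ suc d * ((suc j + suc j + d) C suc j) →
         suc (suc j + suc d) * (ballot j (suc (suc d)) + ballot (suc j) d) ≡ suc (suc d) * (suc N C suc j)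
  step ih₁ ih₂ = begin
    suc (suc j + suc d) * (ballot j (suc (suc d)) + ballot (suc j) d)
      ≡⟨ ballot-step j d {N C j} {N C suc j} absorb
           (trans ih₁ (cong (λ n → suc (suc (suc d)) * (n C j)) (e₂ j d)))
           (trans ih₂ (cong (λ n → suc d * (n C suc j)) (e₃ j d))) ⟩
    suc (suc d) * (N C j + N C suc j)
      ≡⟨ cong (suc (suc d) *_) (pascal N j) ⟨
    suc (suc d) * (suc N C suc j)
      ∎
    where open ≡-Reasoning

catalan : ∀ m → suc m * ballot m 0 ≡ (m + m) C m
catalan m = begin
  suc m * ballot m 0            ≡⟨ cong (λ n → suc n * ballot m 0) (+-identityʳ m) ⟨
  suc (m + 0) * ballot m 0      ≡⟨ ballot-formula m 0 ⟩
  1 * ((m + m + 0) C m)         ≡⟨ *-identityˡ _ ⟩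
  (m + m + 0) C m               ≡⟨ cong (_C m) (+-identityʳ (m + m)) ⟩
  (m + m) C m                   ∎
  where open ≡-Reasoning

theorem35 : (n : ℕ) → 1 ≤ n → PP1234 n ⤖ LatticePaths n
theorem35 (suc m) _ = ↔⇒⤖ (begin
  PP1234 (suc m)                      ↔⟨ PP1234↔Fin×Av123 m ⟩
  (Fin (suc m) × Av123 m)             ↔⟨ ↔-refl ×-↔ Av123↔Fin-ballot m ⟩
  (Fin (suc m) × Fin (ballot m 0))    ↔⟨ *↔× ⟨
  Fin (suc m * ballot m 0)            ≡⟨ cong Fin (catalan m) ⟩
  Fin ((m + m) C m)                   ↔⟨ LatticePaths↔Fin m ⟨
  LatticePaths (suc m)                ∎)
  where open EquationalReasoning
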